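{- For every integer $n\ge 1$, $\chi_{la}(C_{2n+1}\vee O_{2n})=4$.
   Context: For a connected graph $H=(V,E)$, a local antimagic labeling is a bijection $f:E\to\{1,\dots,|E|\}$ such that $f^+(x)\neq f^+(y)$ for every pair of adjacent vertices $x,y$, where $f^+(x)=\sum_{e\in E(x)}f(e)$ is the sum of labels of edges incident to $x$. The local antimagic chromatic number $\chi_{la}(H)$ is the minimum number of distinct values of $f^+$ over all local antimagic labelings $f$ of $H$. $C_k$ is the cycle of order $k$, $O_k$ is the null (edgeless) graph of order $k$, and $G\vee H$ is the join of $G$ and $H$ (disjoint union plus all edges between $V(G)$ and $V(H)$). -}

module Defs where

open import Data.Nat using (ℕ; zero; suc; _+_; _*_; _≤_; _%_)
open import Data.Nat.DivMod using (m%n<n)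
open import Data.Nat.ListAction using (sum)
open import Data.Fin as Fin using (Fin; toℕ; fromℕ<)
open import Data.List using (List; length; map; allFin; deduplicate; concatMap; lookup; _++_)
open import Data.Product using (_×_; _,_; proj₁; proj₂; Σ)
open import Data.Sum using (_⊎_)
open import Relation.Nullary using (¬_; Dec; yes; no)
open import Relation.Binary.PropositionalEquality using (_≡_)
open import Function.Definitions using (Injective)

record Graph : Set where
  field
    order : ℕ
    edges : List (Fin order × Fin order)

  size : ℕ
  size = length edges

  ends : Fin size → Fin order × Fin order
  ends = lookup edges

  Adjacent : Fin order → Fin order → Set
  Adjacent x y = Σ (Fin size) λ e → (ends e ≡ (x , y)) ⊎ (ends e ≡ (y , x))

open Graph public

-- An edge labeling: a bijection f : E → {1,…,|E|}; encoded as an injective map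
-- Fin size → Fin size (injective self-map of a finite set = bijection), label e = 1 + toℕ (f e).
Labeling : Graph → Set
Labeling G = Σ (Fin (size G) → Fin (size G)) λ f → Injective _≡_ _≡_ f

label : (G : Graph) → Labeling G → Fin (size G) → ℕ
label G (f , _) e = suc (toℕ (f e))

incident : (G : Graph) → Fin (order G) → Fin (size G) → Set
incident G x e = (proj₁ (ends G e) ≡ x) ⊎ (proj₂ (ends G e) ≡ x)

contrib : (G : Graph) → Labeling G → Fin (order G) → Fin (size G) → ℕ
contrib G f x e with proj₁ (ends G e) Fin.≟ x | proj₂ (ends G e) Fin.≟ x
... | yes _ | _     = label G f e
... | no _  | yes _ = label G f e
... | no _  | no _  = 0

vertexSum : (G : Graph) → Labeling G → Fin (order G) → ℕ
vertexSum G f x = sum (map (contrib G f x) (allFin (size G)))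

IsLocalAntimagic : (G : Graph) → Labeling G → Set
IsLocalAntimagic G f = ∀ x y → Adjacent G x y → ¬ (vertexSum G f x ≡ vertexSum G f y)

numColours : (G : Graph) → Labeling G → ℕ
numColours G f = length (deduplicate Data.Nat._≟_ (map (vertexSum G f) (allFin (order G))))
  where import Data.Nat

LocalAntimagicChromaticNumberIs : Graph → ℕ → Set
LocalAntimagicChromaticNumberIs G k =
  (Σ (Labeling G) λ f → IsLocalAntimagic G f × (numColours G f ≡ k))
  × (∀ f → IsLocalAntimagic G f → k ≤ numColours G f)

-- C_{2n+1} ∨ O_{2n}: vertices 0..2n form the cycle (i ~ i+1 mod 2n+1),
-- vertices 2n+1 .. 4n form the null graph, each joined to every cycle vertex.
cycVert : (n : ℕ) → Fin (suc (2 * n)) → Fin (suc (2 * n) + 2 * n)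
cycVert n i = i Fin.↑ˡ (2 * n)

nulVert : (n : ℕ) → Fin (2 * n) → Fin (suc (2 * n) + 2 * n)
nulVert n j = suc (2 * n) Fin.↑ʳ j

nextCyc : (n : ℕ) → Fin (suc (2 * n)) → Fin (suc (2 * n))
nextCyc n i = fromℕ< (m%n<n (suc (toℕ i)) (suc (2 * n)))

oddCycleJoinNull : ℕ → Graph
oddCycleJoinNull n = record
  { order = suc (2 * n) + 2 * n
  ; edges =
      map (λ i → (cycVert n i , cycVert n (nextCyc n i))) (allFin (suc (2 * n)))
      ++ concatMap (λ i → map (λ j → (cycVert n i , nulVert n j)) (allFin (2 * n)))
                   (allFin (suc (2 * n)))
  }

-- Write m = 2n + 1. Lower bound: the rim C_m is an odd cycle, so the vertex sums along it take
-- three values, and every vertex of O_{2n} is adjacent to the whole rim, so it carries a fourth.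
-- Upper bound: the labels are 1 + the entries of the square
--   magic p k = m ((p + k) mod m) + ((p - k) mod m),
-- which enumerates 0 .. m² - 1 and has all row and column sums equal to magicSum. Column 0 labels
-- the rim (the edge from i to i + 1 gets row rimRow i), and columns 1 .. 2n of row spokeRow i label
-- the spokes at rim vertex i, for two permutations rimRow, spokeRow of 0 .. 2n. A null vertex then
-- sees a whole column and gets m + magicSum. A rim vertex sees its spoke row without its column-0
-- entry, plus two column-0 entries; since magic p 0 = (m + 1) p its sum is magicSum + (m + 1)(n + c),
-- and the permutations are chosen so that c is 1 at vertex 0, 0 at odd and 2 at even vertices.

module Submission where

open import Defs
open import Data.Nat
  using (ℕ; zero; suc; _+_; _*_; _∸_; _<_; _≤_; z≤n; s≤s; s≤s⁻¹; _%_; _<?_; _≟_; NonZero; >-nonZero; pred)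
open import Data.Nat.DivMod
open import Data.Nat.Properties
open import Data.Nat.ListAction using (sum)
open import Data.Nat.ListAction.Properties using (sum-++)
open import Data.Fin as Fin using (Fin; toℕ; fromℕ<)
import Data.Fin.Properties as Finₚ
import Data.Fin.Relation.Unary.Top as Top
open import Data.List using (List; []; _∷_; _++_; map; concat; upTo; tabulate; length; lookup; allFin)
import Data.List.Properties as Listₚ
open import Data.List.Membership.Propositional using (_∈_)
open import Data.List.Membership.Propositional.Properties
  using ( ∈-lookup; ∈-map⁺; ∈-map⁻; ∈-allFin; ∈-deduplicate⁺; ∈-deduplicate⁻; ∈-++⁺ˡ; ∈-++⁺ʳ; ∈-++⁻
        ; ∈-concat⁺′; ∈-concat⁻′; ∈-upTo⁺)
open import Data.List.Membership.Setoid.Properties using (index-injective)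
open import Data.List.Relation.Binary.Subset.Propositional using (_⊆_)
open import Data.List.Relation.Unary.All as All using ([]; _∷_)
open import Data.List.Relation.Unary.Any as Any using (here)
open import Data.List.Relation.Unary.Any.Properties using (lookup-index)
open import Data.List.Relation.Unary.Unique.Propositional using (Unique; []; _∷_)
open import Data.List.Relation.Unary.Unique.DecPropositional.Properties using (deduplicate-!)
import Data.List.Relation.Unary.Unique.Propositional.Properties as Uniqueₚ
open import Data.Empty using (⊥-elim)
open import Data.Product using (∃; _×_; _,_; proj₁; proj₂)
open import Data.Sum as Sum using (_⊎_; inj₁; inj₂)
open import Function using (_∘_)
open import Function.Definitions using (Injective)
open import Relation.Binary.Definitions using (DecidableEquality)
open import Relation.Binary.PropositionalEquality
open import Relation.Nullary using (¬_; yes; no)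
open import Data.Nat.Tactic.RingSolver using (solve-∀)
open import Algebra.Properties.CommutativeSemigroup +-commutativeSemigroup using (interchange; x∙yz≈y∙xz)

∑< : ℕ → (ℕ → ℕ) → ℕ
∑< zero    h = 0
∑< (suc k) h = h 0 + ∑< k (h ∘ suc)

∑-cong : ∀ k {g h} → (∀ i → i < k → g i ≡ h i) → ∑< k g ≡ ∑< k h
∑-cong zero    eq = refl
∑-cong (suc k) eq = cong₂ _+_ (eq 0 (s≤s z≤n)) (∑-cong k (λ i i<k → eq (suc i) (s≤s i<k)))

∑-distrib-+ : ∀ k g h → ∑< k (λ i → g i + h i) ≡ ∑< k g + ∑< k h
∑-distrib-+ zero    g h = refl
∑-distrib-+ (suc k) g h = trans (cong (g 0 + h 0 +_) (∑-distrib-+ k (g ∘ suc) (h ∘ suc)))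
                                 (interchange (g 0) (h 0) _ _)

∑-*ˡ : ∀ k c h → ∑< k (λ i → c * h i) ≡ c * ∑< k h
∑-*ˡ zero    c h = sym (*-zeroʳ c)
∑-*ˡ (suc k) c h = trans (cong (c * h 0 +_) (∑-*ˡ k c (h ∘ suc))) (sym (*-distribˡ-+ c (h 0) _))

∑-suc : ∀ k h → ∑< k (suc ∘ h) ≡ k + ∑< k h
∑-suc zero    h = refl
∑-suc (suc k) h = cong suc (trans (cong (h 0 +_) (∑-suc k (h ∘ suc))) (x∙yz≈y∙xz (h 0) k _))

∑-split : ∀ a b h → ∑< (a + b) h ≡ ∑< a h + ∑< b (λ i → h (a + i))
∑-split zero    b h = refl
∑-split (suc a) b h = trans (cong (h 0 +_) (∑-split a b (h ∘ suc))) (sym (+-assoc (h 0) _ _))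

∑-last : ∀ a h → ∑< (suc a) h ≡ ∑< a h + h a
∑-last zero    h = +-identityʳ (h 0)
∑-last (suc a) h = trans (cong (h 0 +_) (∑-last a (h ∘ suc))) (sym (+-assoc (h 0) _ _))

∑-reverse : ∀ a h → ∑< a h ≡ ∑< a (λ i → h (a ∸ suc i))
∑-reverse zero    h = refl
∑-reverse (suc a) h = trans (∑-last a h) (trans (+-comm _ (h a)) (cong (h a +_) (∑-reverse a h)))

module _ (m : ℕ) .{{_ : NonZero m}} where

  ∑-rotate : ∀ k g → k ≤ m → ∑< m (λ p → g ((p + k) % m)) ≡ ∑< m g
  ∑-rotate k g k≤m = begin
    ∑< m rotated                                      ≡⟨ cong (λ z → ∑< z rotated) (sym r+k≡m) ⟩
    ∑< (r + k) rotated                                ≡⟨ ∑-split r k rotated ⟩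
    ∑< r rotated + ∑< k (λ i → rotated (r + i))       ≡⟨ cong₂ _+_ (∑-cong r before) (∑-cong k after) ⟩
    ∑< r (λ i → g (k + i)) + ∑< k g                   ≡⟨ +-comm _ (∑< k g) ⟩
    ∑< k g + ∑< r (λ i → g (k + i))                   ≡⟨ sym (∑-split k r g) ⟩
    ∑< (k + r) g                                      ≡⟨ cong (λ z → ∑< z g) (trans (+-comm k r) r+k≡m) ⟩
    ∑< m g                                            ∎
    where
    open ≡-Reasoning
    rotated : ℕ → ℕ
    rotated p = g ((p + k) % m)
    r : ℕ
    r = m ∸ k
    r+k≡m : r + k ≡ m
    r+k≡m = m∸n+n≡m k≤m
    before : ∀ i → i < r → rotated i ≡ g (k + i)
    before i i<r = cong g (trans (m<n⇒m%n≡m (subst (i + k <_) r+k≡m (+-monoˡ-< k i<r))) (+-comm i k))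
    after : ∀ i → i < k → rotated (r + i) ≡ g i
    after i i<k = cong g (begin
      (r + i + k) % m   ≡⟨ cong (_% m) (trans (+-assoc r i k) (trans (cong (r +_) (+-comm i k)) (sym (+-assoc r k i)))) ⟩
      (r + k + i) % m   ≡⟨ cong (_% m) (trans (cong (_+ i) r+k≡m) (+-comm m i)) ⟩
      (i + m) % m       ≡⟨ [m+n]%n≡m%n i m ⟩
      i % m             ≡⟨ m<n⇒m%n≡m (<-≤-trans i<k k≤m) ⟩
      i                 ∎)


sum-tabulate-toℕ : ∀ {k} (h : Fin k → ℕ) g → (∀ i → h i ≡ g (toℕ i)) → sum (tabulate h) ≡ ∑< k g
sum-tabulate-toℕ {k = zero}  h g eq = refl
sum-tabulate-toℕ {k = suc k} h g eq =
  cong₂ _+_ (eq Fin.zero) (sum-tabulate-toℕ (h ∘ Fin.suc) (g ∘ suc) (eq ∘ Fin.suc))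

sum-tabulate-zero : ∀ {k} (h : Fin k → ℕ) → (∀ i → h i ≡ 0) → sum (tabulate h) ≡ 0
sum-tabulate-zero {k = zero}  h h≡0 = refl
sum-tabulate-zero {k = suc k} h h≡0 = cong₂ _+_ (h≡0 Fin.zero) (sum-tabulate-zero (h ∘ Fin.suc) (h≡0 ∘ Fin.suc))

sum-tabulate-single : ∀ {k} (h : Fin k → ℕ) j → (∀ i → i ≢ j → h i ≡ 0) → sum (tabulate h) ≡ h j
sum-tabulate-single {k = suc k} h Fin.zero    h≡0 =
  trans (cong (h Fin.zero +_) (sum-tabulate-zero (h ∘ Fin.suc) (λ i → h≡0 (Fin.suc i) λ ()))) (+-identityʳ _)
sum-tabulate-single {k = suc k} h (Fin.suc j) h≡0 =
  cong₂ _+_ (h≡0 Fin.zero λ ())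
            (sum-tabulate-single (h ∘ Fin.suc) j (λ i i≢j → h≡0 (Fin.suc i) (i≢j ∘ Finₚ.suc-injective)))

sum-tabulate-pair : ∀ {k} (h : Fin k → ℕ) j j′ → j ≢ j′ → (∀ i → i ≢ j → i ≢ j′ → h i ≡ 0) →
                    sum (tabulate h) ≡ h j + h j′
sum-tabulate-pair {k = suc k} h Fin.zero    Fin.zero     j≢j′ h≡0 = ⊥-elim (j≢j′ refl)
sum-tabulate-pair {k = suc k} h Fin.zero    (Fin.suc j′) j≢j′ h≡0 =
  cong (h Fin.zero +_)
       (sum-tabulate-single (h ∘ Fin.suc) j′ λ i i≢j′ → h≡0 (Fin.suc i) (λ ()) (i≢j′ ∘ Finₚ.suc-injective))
sum-tabulate-pair {k = suc k} h (Fin.suc j) Fin.zero     j≢j′ h≡0 =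
  trans (cong (h Fin.zero +_)
              (sum-tabulate-single (h ∘ Fin.suc) j λ i i≢j → h≡0 (Fin.suc i) (i≢j ∘ Finₚ.suc-injective) λ ()))
        (+-comm (h Fin.zero) _)
sum-tabulate-pair {k = suc k} h (Fin.suc j) (Fin.suc j′) j≢j′ h≡0 =
  cong₂ _+_ (h≡0 Fin.zero (λ ()) (λ ()))
            (sum-tabulate-pair (h ∘ Fin.suc) j j′ (j≢j′ ∘ cong Fin.suc)
               (λ i i≢j i≢j′ → h≡0 (Fin.suc i) (i≢j ∘ Finₚ.suc-injective) (i≢j′ ∘ Finₚ.suc-injective)))

sum-concat : ∀ (xss : List (List ℕ)) → sum (concat xss) ≡ sum (map sum xss)
sum-concat []         = refl
sum-concat (xs ∷ xss) = trans (sum-++ xs (concat xss)) (cong (sum xs +_) (sum-concat xss))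

length-concat-uniform : ∀ {A B : Set} (xs : List A) (h : A → List B) L → (∀ x → length (h x) ≡ L) →
                        length (concat (map h xs)) ≡ length xs * L
length-concat-uniform []       h L eq = refl
length-concat-uniform (x ∷ xs) h L eq =
  trans (Listₚ.length-++ (h x)) (cong₂ _+_ (eq x) (length-concat-uniform xs h L eq))

module _ {A : Set} where

  lookup-injective : ∀ {xs : List A} → Unique xs → ∀ i j → lookup xs i ≡ lookup xs j → i ≡ j
  lookup-injective {x ∷ xs} _          Fin.zero    Fin.zero    _ = refl
  lookup-injective {x ∷ xs} (x∉ ∷ _)   Fin.zero    (Fin.suc j) eq = ⊥-elim (All.lookup x∉ (∈-lookup j) eq)
  lookup-injective {x ∷ xs} (x∉ ∷ _)   (Fin.suc i) Fin.zero    eq = ⊥-elim (All.lookup x∉ (∈-lookup i) (sym eq))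
  lookup-injective {x ∷ xs} (_ ∷ uniq) (Fin.suc i) (Fin.suc j) eq = cong Fin.suc (lookup-injective uniq i j eq)

  Unique-⊆⇒length≤ : ∀ {xs ys : List A} → Unique xs → xs ⊆ ys → length xs ≤ length ys
  Unique-⊆⇒length≤ {xs} uniq xs⊆ys = Finₚ.injective⇒≤ position-injective
    where
    position : Fin (length xs) → Fin _
    position i = Any.index (xs⊆ys (∈-lookup i))
    position-injective : Injective _≡_ _≡_ position
    position-injective {i} {j} eq =
      lookup-injective uniq i j (index-injective (setoid A) (xs⊆ys (∈-lookup i)) (xs⊆ys (∈-lookup j)) eq)

-- Parity and odd cycles

double : ℕ → ℕ
double zero    = zero
double (suc k) = suc (suc (double k))

double≡2* : ∀ k → double k ≡ 2 * k
double≡2* zero    = refl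
double≡2* (suc k) = trans (cong (suc ∘ suc) (double≡2* k)) (sym (*-suc 2 k))

data EvenOdd : ℕ → Set where
  even : ∀ k → EvenOdd (double k)
  odd  : ∀ k → EvenOdd (suc (double k))

evenOdd : ∀ a → EvenOdd a
evenOdd zero    = even 0
evenOdd (suc a) with evenOdd a
... | even k = odd k
... | odd k  = even (suc k)

double-cancel-≤ : ∀ {a b} → double a ≤ double b → a ≤ b
double-cancel-≤ {zero}  _               = z≤n
double-cancel-≤ {suc a} {suc b} (s≤s (s≤s le)) = s≤s (double-cancel-≤ le)

double-cancel-< : ∀ {a b} → double a < double b → a < b
double-cancel-< {zero}  {suc b} _               = s≤s z≤n
double-cancel-< {suc a} {suc b} (s≤s (s≤s lt)) = s≤s (double-cancel-< lt)

module _ {A : Set} where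

  alternate : A → A → ℕ → A
  alternate a b zero    = a
  alternate a b (suc i) = alternate b a i

  alternate-double : ∀ a b k → alternate a b (double k) ≡ a
  alternate-double a b zero    = refl
  alternate-double a b (suc k) = alternate-double a b k

  alternate-next : ∀ {a b z} i → a ≢ b → z ≡ a ⊎ z ≡ b → z ≢ alternate a b i → z ≡ alternate a b (suc i)
  alternate-next zero    a≢b (inj₁ z≡a) z≢a = ⊥-elim (z≢a z≡a)
  alternate-next zero    a≢b (inj₂ z≡b) z≢a = z≡b
  alternate-next (suc i) a≢b z∈         z≢  = alternate-next i (a≢b ∘ sym) (Sum.swap z∈) z≢

  ThirdColour : ℕ → (ℕ → A) → Set
  ThirdColour L c = ∃ λ j → j ≤ L × c j ≢ c 0 × c j ≢ c 1

module _ {A : Set} (_≟_ : DecidableEquality A) where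

  twoColoured⇒alternate : ∀ {L} (c : ℕ → A) → (∀ i → i < L → c i ≢ c (suc i)) →
                          ∀ i → i ≤ L → ThirdColour L c ⊎ c i ≡ alternate (c 0) (c 1) i
  twoColoured⇒alternate c proper zero    _    = inj₂ refl
  twoColoured⇒alternate c proper (suc i) i<L with twoColoured⇒alternate c proper i (<⇒≤ i<L)
  ... | inj₁ third = inj₁ third
  ... | inj₂ cᵢ≡ with c (suc i) ≟ c 0 | c (suc i) ≟ c 1
  ...   | no ≢c₀  | no ≢c₁ = inj₁ (suc i , i<L , ≢c₀ , ≢c₁)
  ...   | yes ≡c₀ | _       = inj₂ (alternate-next i (proper 0 (≤-trans (s≤s z≤n) i<L)) (inj₁ ≡c₀)
                                         λ eq → proper i i<L (trans cᵢ≡ (sym eq)))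
  ...   | no _    | yes ≡c₁ = inj₂ (alternate-next i (proper 0 (≤-trans (s≤s z≤n) i<L)) (inj₂ ≡c₁)
                                         λ eq → proper i i<L (trans cᵢ≡ (sym eq)))

  oddCycle-thirdColour : ∀ k (c : ℕ → A) → (∀ i → i < double k → c i ≢ c (suc i)) → c (double k) ≢ c 0 →
                         ThirdColour (double k) c
  oddCycle-thirdColour k c proper closing with twoColoured⇒alternate c proper (double k) ≤-refl
  ... | inj₁ third = third
  ... | inj₂ eq    = ⊥-elim (closing (trans eq (alternate-double (c 0) (c 1) k)))

weightAt : ∀ {k} → Fin k → Fin k × Fin k → ℕ → ℕ
weightAt x (a , b) v with a Fin.≟ x | b Fin.≟ x
... | yes _ | _     = v
... | no _  | yes _ = v
... | no _  | no _  = 0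

module _ {k} {x a b : Fin k} {v : ℕ} where

  weightAt-fst : a ≡ x → weightAt x (a , b) v ≡ v
  weightAt-fst a≡x with a Fin.≟ x
  ... | yes _   = refl
  ... | no a≢x = ⊥-elim (a≢x a≡x)

  weightAt-snd : b ≡ x → weightAt x (a , b) v ≡ v
  weightAt-snd b≡x with a Fin.≟ x | b Fin.≟ x
  ... | yes _ | _       = refl
  ... | no _  | yes _   = refl
  ... | no _  | no b≢x = ⊥-elim (b≢x b≡x)

  weightAt-neither : a ≢ x → b ≢ x → weightAt x (a , b) v ≡ 0
  weightAt-neither a≢x b≢x with a Fin.≟ x | b Fin.≟ x
  ... | yes a≡x | _       = ⊥-elim (a≢x a≡x)
  ... | no _    | yes b≡x = ⊥-elim (b≢x b≡x)
  ... | no _    | no _    = refl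

module _ (G : Graph) where

  private
    Pair : Set
    Pair = Fin (order G) × Fin (order G)

  contrib≡weightAt : ∀ f x e → contrib G f x e ≡ weightAt x (ends G e) (label G f e)
  contrib≡weightAt f x e with proj₁ (ends G e) Fin.≟ x | proj₂ (ends G e) Fin.≟ x
  ... | yes _ | _     = refl
  ... | no _  | yes _ = refl
  ... | no _  | no _  = refl

  vertexSum-byEdges : ∀ f (w : Pair → ℕ) → (∀ e → label G f e ≡ w (ends G e)) →
                      ∀ x → vertexSum G f x ≡ sum (map (λ p → weightAt x p (w p)) (edges G))
  vertexSum-byEdges f w label≡w x = cong sum (begin
    map (contrib G f x) (allFin (size G))
      ≡⟨ Listₚ.map-cong (λ e → trans (contrib≡weightAt f x e) (cong (weightAt x (ends G e)) (label≡w e))) _ ⟩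
    map (weight ∘ ends G) (allFin (size G))
      ≡⟨ Listₚ.map-tabulate (λ e → e) (weight ∘ ends G) ⟩
    tabulate (weight ∘ lookup (edges G))
      ≡⟨ sym (Listₚ.map-tabulate (lookup (edges G)) weight) ⟩
    map weight (tabulate (lookup (edges G)))
      ≡⟨ cong (map weight) (Listₚ.tabulate-lookup (edges G)) ⟩
    map weight (edges G) ∎)
    where
    open ≡-Reasoning
    weight : Pair → ℕ
    weight p = weightAt x p (w p)

  ∈-edges⇒adjacent : ∀ {x y} → (x , y) ∈ edges G → Adjacent G x y
  ∈-edges⇒adjacent mem = Any.index mem , inj₁ (sym (lookup-index mem))

  isLocalAntimagic-byEdges : ∀ f → (∀ {x y} → (x , y) ∈ edges G → vertexSum G f x ≢ vertexSum G f y) →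
                             IsLocalAntimagic G f
  isLocalAntimagic-byEdges f proper x y (e , inj₁ eq) = proper (subst (_∈ edges G) eq (∈-lookup e))
  isLocalAntimagic-byEdges f proper x y (e , inj₂ eq) = proper (subst (_∈ edges G) eq (∈-lookup e)) ∘ sym

  module _ (code : Pair → ℕ) (code< : ∀ e → code (ends G e) < size G) (simple : Unique (edges G))
           (code-injective : ∀ {p q} → p ∈ edges G → q ∈ edges G → code p ≡ code q → p ≡ q) where

    codeLabeling : Labeling G
    codeLabeling = (λ e → fromℕ< (code< e)) , λ {e} {e′} eq →
      lookup-injective simple e e′ (code-injective (∈-lookup e) (∈-lookup e′)
        (trans (sym (Finₚ.toℕ-fromℕ< (code< e))) (trans (cong toℕ eq) (Finₚ.toℕ-fromℕ< (code< e′)))))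

    label-codeLabeling : ∀ e → label G codeLabeling e ≡ suc (code (ends G e))
    label-codeLabeling e = cong suc (Finₚ.toℕ-fromℕ< (code< e))

  module _ (f : Labeling G) where

    private
      values : List ℕ
      values = map (vertexSum G f) (allFin (order G))

    numColours≤ : ∀ {ys} → (∀ x → vertexSum G f x ∈ ys) → numColours G f ≤ length ys
    numColours≤ {ys} all∈ = Unique-⊆⇒length≤ (deduplicate-! _≟_ values) λ mem →
      let x , _ , eq = ∈-map⁻ (vertexSum G f) (∈-deduplicate⁻ _≟_ values mem)
      in subst (_∈ ys) (sym eq) (all∈ x)

    ≤numColours : ∀ xs → Unique (map (vertexSum G f) xs) → length (map (vertexSum G f) xs) ≤ numColours G f
    ≤numColours xs uniq = Unique-⊆⇒length≤ uniq λ mem →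
      let x , _ , eq = ∈-map⁻ (vertexSum G f) mem
      in ∈-deduplicate⁺ _≟_ (subst (_∈ values) (sym eq) (∈-map⁺ (vertexSum G f) (∈-allFin x)))

    oddWheel⇒4≤numColours : IsLocalAntimagic G f → ∀ k (c : ℕ → Fin (order G)) apex →
      (∀ i → i < double k → Adjacent G (c i) (c (suc i))) → Adjacent G (c (double k)) (c 0) →
      (∀ i → Adjacent G (c i) apex) → 4 ≤ numColours G f
    oddWheel⇒4≤numColours antimagic zero    c apex _      closing _   = ⊥-elim (antimagic _ _ closing refl)
    oddWheel⇒4≤numColours antimagic (suc k) c apex around closing hub =
      ≤numColours (c 0 ∷ c 1 ∷ c j ∷ apex ∷ [])
        ((c₀≢c₁ ∷ (cⱼ≢c₀ ∘ sym) ∷ ≢apex 0 ∷ []) ∷ ((cⱼ≢c₁ ∘ sym) ∷ ≢apex 1 ∷ []) ∷ (≢apex j ∷ []) ∷ [] ∷ [])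
      where
      colour : ℕ → ℕ
      colour = vertexSum G f ∘ c
      third : ThirdColour (double (suc k)) colour
      third = oddCycle-thirdColour _≟_ (suc k) colour
                (λ i i<L → antimagic _ _ (around i i<L)) (antimagic _ _ closing)
      j : ℕ
      j = proj₁ third
      cⱼ≢c₀ : colour j ≢ colour 0
      cⱼ≢c₀ = proj₁ (proj₂ (proj₂ third))
      cⱼ≢c₁ : colour j ≢ colour 1
      cⱼ≢c₁ = proj₂ (proj₂ (proj₂ third))
      c₀≢c₁ : colour 0 ≢ colour 1
      c₀≢c₁ = antimagic _ _ (around 0 (s≤s z≤n))
      ≢apex : ∀ i → colour i ≢ vertexSum G f apex
      ≢apex i = antimagic _ _ (hub i)

-- The magic square

module _ (m : ℕ) .{{_ : NonZero m}} where

  %-cong-*ˡ : ∀ c a b → a % m ≡ b % m → (c * a) % m ≡ (c * b) % m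
  %-cong-*ˡ c a b eq =
    trans (%-distribˡ-* c a m) (trans (cong (λ z → (c % m * z) % m) eq) (sym (%-distribˡ-* c b m)))

  %-cong-+ : ∀ a b c d → a % m ≡ c % m → b % m ≡ d % m → (a + b) % m ≡ (c + d) % m
  %-cong-+ a b c d eq₁ eq₂ =
    trans (%-distribˡ-+ a b m) (trans (cong₂ (λ x y → (x + y) % m) eq₁ eq₂) (sym (%-distribˡ-+ c d m)))

  [m*q+r]%m≡r : ∀ q r → r < m → (m * q + r) % m ≡ r
  [m*q+r]%m≡r q r r<m = trans (cong (_% m) (trans (+-comm (m * q) r) (cong (r +_) (*-comm m q))))
                              (trans ([m+kn]%n≡m%n r q m) (m<n⇒m%n≡m r<m))

  digits-injective : ∀ q r q′ r′ → r < m → r′ < m → m * q + r ≡ m * q′ + r′ → q ≡ q′ × r ≡ r′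
  digits-injective q r q′ r′ r<m r′<m eq = q≡q′ , r≡r′
    where
    r≡r′ : r ≡ r′
    r≡r′ = trans (sym ([m*q+r]%m≡r q r r<m)) (trans (cong (_% m) eq) ([m*q+r]%m≡r q′ r′ r′<m))
    q≡q′ : q ≡ q′
    q≡q′ = *-cancelˡ-≡ q q′ m (+-cancelʳ-≡ _ _ _ (trans eq (cong (m * q′ +_) (sym r≡r′))))

module MagicSquare (n : ℕ) where

  m : ℕ
  m = suc (2 * n)

  magic : ℕ → ℕ → ℕ
  magic p k = m * ((p + k) % m) + (p + (m ∸ k)) % m

  magicSum : ℕ
  magicSum = m * ∑< m (λ i → i) + ∑< m (λ i → i)

  magic<m*m : ∀ p k → magic p k < m * m
  magic<m*m p k = begin-strict
    m * ((p + k) % m) + (p + (m ∸ k)) % m <⟨ +-monoʳ-< (m * ((p + k) % m)) (m%n<n (p + (m ∸ k)) m) ⟩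
    m * ((p + k) % m) + m                 ≡⟨ +-comm _ m ⟩
    m + m * ((p + k) % m)                 ≡⟨ sym (*-suc m _) ⟩
    m * suc ((p + k) % m)                 ≤⟨ *-monoʳ-≤ m (m%n<n (p + k) m) ⟩
    m * m                                 ∎
    where open ≤-Reasoning

  magic-column₀ : ∀ p → p < m → magic p 0 ≡ suc m * p
  magic-column₀ p p<m = begin
    m * ((p + 0) % m) + (p + m) % m ≡⟨ cong₂ (λ a b → m * a + b)
                                               (trans (cong (_% m) (+-identityʳ p)) (m<n⇒m%n≡m p<m))
                                               (trans ([m+n]%n≡m%n p m) (m<n⇒m%n≡m p<m)) ⟩
    m * p + p                       ≡⟨ +-comm (m * p) p ⟩
    suc m * p                       ∎
    where open ≡-Reasoning

  private
    ∑-digits : ∀ f g → ∑< m (λ i → m * f i + g i) ≡ m * ∑< m f + ∑< m g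
    ∑-digits f g = trans (∑-distrib-+ m (λ i → m * f i) g) (cong (_+ ∑< m g) (∑-*ˡ m m f))

  ∑-magic-column : ∀ k → k ≤ m → ∑< m (λ p → magic p k) ≡ magicSum
  ∑-magic-column k k≤m = trans (∑-digits (λ p → (p + k) % m) (λ p → (p + (m ∸ k)) % m))
    (cong₂ (λ a b → m * a + b) (∑-rotate m k (λ i → i) k≤m) (∑-rotate m (m ∸ k) (λ i → i) (m∸n≤m m k)))

  ∑-magic-row : ∀ p → p < m → ∑< m (magic p) ≡ magicSum
  ∑-magic-row p p<m = trans (∑-digits (λ k → (p + k) % m) (λ k → (p + (m ∸ k)) % m))
    (cong₂ (λ a b → m * a + b) ascending descending)
    where
    ascending : ∑< m (λ k → (p + k) % m) ≡ ∑< m (λ i → i)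
    ascending = trans (∑-cong m (λ i _ → cong (_% m) (+-comm p i))) (∑-rotate m p (λ i → i) (<⇒≤ p<m))
    descending : ∑< m (λ k → (p + (m ∸ k)) % m) ≡ ∑< m (λ i → i)
    descending = begin
      ∑< m (λ k → (p + (m ∸ k)) % m)          ≡⟨ ∑-reverse m (λ k → (p + (m ∸ k)) % m) ⟩
      ∑< m (λ i → (p + (m ∸ (m ∸ suc i))) % m) ≡⟨ ∑-cong m (λ i i<m → cong (λ z → (p + z) % m) (m∸[m∸n]≡n i<m)) ⟩
      ∑< m (λ i → (p + suc i) % m)            ≡⟨ ∑-cong m (λ i _ → cong (_% m) (trans (+-comm p (suc i)) (sym (+-suc i p)))) ⟩
      ∑< m (λ i → (i + suc p) % m)            ≡⟨ ∑-rotate m (suc p) (λ i → i) p<m ⟩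
      ∑< m (λ i → i)                          ∎
      where open ≡-Reasoning

  magic-injective : ∀ {p k p′ k′} → p < m → k < m → p′ < m → k′ < m → magic p k ≡ magic p′ k′ → p ≡ p′ × k ≡ k′
  magic-injective {p} {k} {p′} {k′} p<m k<m p′<m k′<m eq = p≡p′ , k≡k′
    where
    digits : (p + k) % m ≡ (p′ + k′) % m × (p + (m ∸ k)) % m ≡ (p′ + (m ∸ k′)) % m
    digits = digits-injective m _ _ _ _ (m%n<n (p + (m ∸ k)) m) (m%n<n (p′ + (m ∸ k′)) m) eq
    -- adding the two digits eliminates k
    twice : ∀ p k → k < m → ((p + k) + (p + (m ∸ k))) % m ≡ (p + p) % m
    twice p k k<m = trans (cong (_% m) (trans (interchange p k p (m ∸ k))
                                              (cong ((p + p) +_) (m+[n∸m]≡n (<⇒≤ k<m)))))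
                          ([m+n]%n≡m%n (p + p) m)
    -- suc n is the inverse of 2 modulo m
    halve : ∀ p → p < m → (suc n * (p + p)) % m ≡ p
    halve p p<m = trans (cong (_% m) (suc-n*2p n p)) (trans ([m+kn]%n≡m%n p p m) (m<n⇒m%n≡m p<m))
      where suc-n*2p : ∀ n p → suc n * (p + p) ≡ p + p * suc (2 * n)
            suc-n*2p = solve-∀
    p≡p′ : p ≡ p′
    p≡p′ = begin
      p                         ≡⟨ sym (halve p p<m) ⟩
      (suc n * (p + p)) % m     ≡⟨ %-cong-*ˡ m (suc n) (p + p) (p′ + p′) (trans (sym (twice p k k<m))
                                     (trans (%-cong-+ m (p + k) (p + (m ∸ k)) (p′ + k′) (p′ + (m ∸ k′))
                                                      (proj₁ digits) (proj₂ digits))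
                                            (twice p′ k′ k′<m))) ⟩
      (suc n * (p′ + p′)) % m   ≡⟨ halve p′ p′<m ⟩
      p′                        ∎
      where open ≡-Reasoning
    recover : ∀ k → k < m → ((m ∸ p) + (p + k)) % m ≡ k
    recover k k<m = trans (cong (_% m) (trans (sym (+-assoc (m ∸ p) p k))
                            (trans (cong (_+ k) (m∸n+n≡m (<⇒≤ p<m))) (+-comm m k))))
                          (trans ([m+n]%n≡m%n k m) (m<n⇒m%n≡m k<m))
    k≡k′ : k ≡ k′
    k≡k′ = trans (sym (recover k k<m))
           (trans (%-cong-+ m (m ∸ p) (p + k) (m ∸ p) (p + k′) refl
                            (trans (proj₁ digits) (cong (λ z → (z + k′) % m) (sym p≡p′))))
                  (recover k′ k′<m))

-- The rim and spoke rows

module CycleRows (n : ℕ) where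

  m : ℕ
  m = suc (2 * n)

  m≡1+double : m ≡ suc (double n)
  m≡1+double = cong suc (sym (double≡2* n))

  even<m⇒≤n : ∀ {k} → double k < m → k ≤ n
  even<m⇒≤n {k} lt = double-cancel-≤ (s≤s⁻¹ (subst (double k <_) m≡1+double lt))

  odd<m⇒<n : ∀ {k} → suc (double k) < m → k < n
  odd<m⇒<n {k} lt = double-cancel-< (s≤s⁻¹ (subst (suc (double k) <_) m≡1+double lt))

  rimRow : ℕ → ℕ
  rimRow 0             = 0
  rimRow 1             = suc n
  rimRow (suc (suc a)) = suc (rimRow a)

  rimRow-even : ∀ k → rimRow (double k) ≡ k
  rimRow-even zero    = refl
  rimRow-even (suc k) = cong suc (rimRow-even k)

  rimRow-odd : ∀ k → rimRow (suc (double k)) ≡ suc (n + k)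
  rimRow-odd zero    = cong suc (sym (+-identityʳ n))
  rimRow-odd (suc k) = cong suc (trans (rimRow-odd k) (sym (+-suc n k)))

  rimRow-adjacent : ∀ a → rimRow (suc a) + rimRow a ≡ n + suc a
  rimRow-adjacent zero          = trans (+-identityʳ (suc n)) (+-comm 1 n)
  rimRow-adjacent (suc zero)    = +-comm 2 n
  rimRow-adjacent (suc (suc a)) = begin
    suc (rimRow (suc a)) + suc (rimRow a)  ≡⟨ cong suc (+-suc (rimRow (suc a)) (rimRow a)) ⟩
    suc (suc (rimRow (suc a) + rimRow a))  ≡⟨ cong (suc ∘ suc) (rimRow-adjacent a) ⟩
    suc (suc (n + suc a))                  ≡⟨ cong suc (sym (+-suc n (suc a))) ⟩
    suc (n + suc (suc a))                  ≡⟨ sym (+-suc n (suc (suc a))) ⟩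
    n + suc (suc (suc a))                  ∎
    where open ≡-Reasoning

  private
    half≢upper : ∀ {k k′} → k ≤ n → k ≢ suc (n + k′)
    half≢upper {k′ = k′} k≤n refl = <-irrefl refl (<-≤-trans (s≤s (m≤m+n n k′)) k≤n)

  rimRow-< : ∀ a → a < m → rimRow a < m
  rimRow-< a a<m with evenOdd a
  ... | even k = subst (_< m) (sym (rimRow-even k)) (s≤s (≤-trans (even<m⇒≤n a<m) (m≤m+n n (n + 0))))
  ... | odd k  = subst (_< m) (sym (rimRow-odd k))
                   (s≤s (≤-trans (+-monoʳ-< n (odd<m⇒<n a<m)) (≤-reflexive (cong (n +_) (sym (+-identityʳ n))))))

  rimRow-injective : ∀ {a b} → a < m → b < m → rimRow a ≡ rimRow b → a ≡ b
  rimRow-injective {a} {b} a<m b<m eq with evenOdd a | evenOdd b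
  ... | even k | even k′ = cong double (trans (sym (rimRow-even k)) (trans eq (rimRow-even k′)))
  ... | odd k  | odd k′  = cong (suc ∘ double) (+-cancelˡ-≡ n k k′ (suc-injective
                             (trans (sym (rimRow-odd k)) (trans eq (rimRow-odd k′)))))
  ... | even k | odd k′  =
    ⊥-elim (half≢upper (even<m⇒≤n a<m) (trans (sym (rimRow-even k)) (trans eq (rimRow-odd k′))))
  ... | odd k  | even k′ =
    ⊥-elim (half≢upper (even<m⇒≤n b<m) (trans (sym (rimRow-even k′)) (trans (sym eq) (rimRow-odd k))))

  swapPairs : ℕ → ℕ
  swapPairs 0             = 1
  swapPairs 1             = 0
  swapPairs (suc (suc a)) = suc (suc (swapPairs a))

  swapPairs-involutive : ∀ a → swapPairs (swapPairs a) ≡ a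
  swapPairs-involutive 0             = refl
  swapPairs-involutive 1             = refl
  swapPairs-involutive (suc (suc a)) = cong (suc ∘ suc) (swapPairs-involutive a)

  swapPairs-< : ∀ {a} k → a < double k → swapPairs a < double k
  swapPairs-< {0}           (suc k) _              = s≤s (s≤s z≤n)
  swapPairs-< {1}           (suc k) _              = s≤s z≤n
  swapPairs-< {suc (suc a)} (suc k) (s≤s (s≤s lt)) = s≤s (s≤s (swapPairs-< k lt))

  ∑-swapPairs : ∀ k g → ∑< (double k) (g ∘ swapPairs) ≡ ∑< (double k) g
  ∑-swapPairs zero    g = refl
  ∑-swapPairs (suc k) g = begin
    g 1 + (g 0 + ∑< (double k) (g ∘ suc ∘ suc ∘ swapPairs))
      ≡⟨ cong (λ z → g 1 + (g 0 + z)) (∑-swapPairs k (g ∘ suc ∘ suc)) ⟩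
    g 1 + (g 0 + ∑< (double k) (g ∘ suc ∘ suc))
      ≡⟨ x∙yz≈y∙xz (g 1) (g 0) _ ⟩
    g 0 + (g 1 + ∑< (double k) (g ∘ suc ∘ suc)) ∎
    where open ≡-Reasoning

  spokeRow : ℕ → ℕ
  spokeRow 0       = 0
  spokeRow (suc a) = suc (swapPairs a)

  spokeRow-involutive : ∀ a → spokeRow (spokeRow a) ≡ a
  spokeRow-involutive 0       = refl
  spokeRow-involutive (suc a) = cong suc (swapPairs-involutive a)

  spokeRow-< : ∀ a → a < m → spokeRow a < m
  spokeRow-< 0       _          = s≤s z≤n
  spokeRow-< (suc a) (s≤s a<2n) = s≤s (subst (swapPairs a <_) (double≡2* n)
                                    (swapPairs-< n (subst (a <_) (sym (double≡2* n)) a<2n)))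

  ∑-spokeRow : ∀ g → ∑< m (g ∘ spokeRow) ≡ ∑< m g
  ∑-spokeRow g = cong (g 0 +_) (subst (λ L → ∑< L (g ∘ suc ∘ swapPairs) ≡ ∑< L (g ∘ suc)) (double≡2* n)
                                       (∑-swapPairs n (g ∘ suc)))

  pairOffset : ℕ → ℕ
  pairOffset 0             = 0
  pairOffset 1             = 2
  pairOffset (suc (suc a)) = pairOffset a

  swapPairs+pairOffset : ∀ a → swapPairs a + pairOffset a ≡ suc a
  swapPairs+pairOffset 0             = refl
  swapPairs+pairOffset 1             = refl
  swapPairs+pairOffset (suc (suc a)) = cong (suc ∘ suc) (swapPairs+pairOffset a)

  pairOffset-odd : ∀ k → pairOffset (suc (double k)) ≡ 2
  pairOffset-odd zero    = refl
  pairOffset-odd (suc k) = pairOffset-odd k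

  rimColour : ℕ → ℕ
  rimColour 0       = 1
  rimColour (suc a) = pairOffset a

  previous : ℕ → ℕ
  previous 0       = 2 * n
  previous (suc a) = a

  rimRow-balance : ∀ a → rimRow a + rimRow (previous a) + 1 ≡ spokeRow a + (n + rimColour a)
  rimRow-balance 0       = cong (_+ 1) (trans (cong rimRow (sym (double≡2* n))) (rimRow-even n))
  rimRow-balance (suc a) = begin
    rimRow (suc a) + rimRow a + 1                ≡⟨ cong (_+ 1) (rimRow-adjacent a) ⟩
    n + suc a + 1                                ≡⟨ +-comm (n + suc a) 1 ⟩
    suc (n + suc a)                              ≡⟨ cong (suc ∘ (n +_)) (sym (swapPairs+pairOffset a)) ⟩
    suc (n + (swapPairs a + pairOffset a))       ≡⟨ cong suc (x∙yz≈y∙xz n (swapPairs a) (pairOffset a)) ⟩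
    suc (swapPairs a + (n + pairOffset a))       ∎
    where open ≡-Reasoning

  rimColour-< : ∀ a → rimColour a < 3
  rimColour-< 0             = s≤s (s≤s z≤n)
  rimColour-< 1             = s≤s z≤n
  rimColour-< 2             = s≤s (s≤s (s≤s z≤n))
  rimColour-< (suc (suc (suc a))) = rimColour-< (suc a)

  rimColour-step : ∀ a → rimColour a ≢ rimColour (suc a)
  rimColour-step 0             ()
  rimColour-step 1             ()
  rimColour-step 2             ()
  rimColour-step (suc (suc (suc a))) = rimColour-step (suc a)

  rimColour-proper : 1 ≤ n → ∀ a → a < m → rimColour a ≢ rimColour (suc a % m)
  rimColour-proper 1≤n a a<m with a <? 2 * n
  ... | yes a<2n = subst (λ b → rimColour a ≢ rimColour b) (sym (m<n⇒m%n≡m (s≤s a<2n))) (rimColour-step a)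
  ... | no  a≮2n = subst (λ b → rimColour b ≢ rimColour (suc b % m)) (sym a≡2n) closing
    where
    a≡2n : a ≡ 2 * n
    a≡2n = ≤-antisym (s≤s⁻¹ a<m) (≮⇒≥ a≮2n)
    instance
      n≢0 : NonZero n
      n≢0 = >-nonZero 1≤n
    lastColour : rimColour (2 * n) ≡ 2
    lastColour = trans (cong rimColour (trans (sym (double≡2* n)) (cong double (sym (suc-pred n)))))
                       (pairOffset-odd (pred n))
    closing : rimColour (2 * n) ≢ rimColour (suc (2 * n) % m)
    closing eq with trans (sym lastColour) (trans eq (cong rimColour (n%n≡0 m)))
    ... | ()

-- The labeling of C_{2n+1} ∨ O_{2n}

module JoinGraph (n : ℕ) (1≤n : 1 ≤ n) where

  open MagicSquare n
  open CycleRows n hiding (m)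

  G : Graph
  G = oddCycleJoinNull n

  Vertex : Set
  Vertex = Fin (m + 2 * n)

  Pair : Set
  Pair = Vertex × Vertex

  rimEdge : Fin m → Pair
  rimEdge i = cycVert n i , cycVert n (nextCyc n i)

  spoke : Fin m → Fin (2 * n) → Pair
  spoke i j = cycVert n i , nulVert n j

  spokes : Fin m → List Pair
  spokes i = map (spoke i) (allFin (2 * n))

  rimEdges spokeEdges : List Pair
  rimEdges   = map rimEdge (allFin m)
  spokeEdges = concat (map spokes (allFin m))

  cycVert-injective : ∀ {i i′} → cycVert n i ≡ cycVert n i′ → i ≡ i′
  cycVert-injective = Finₚ.↑ˡ-injective (2 * n) _ _

  nulVert-injective : ∀ {j j′} → nulVert n j ≡ nulVert n j′ → j ≡ j′
  nulVert-injective = Finₚ.↑ʳ-injective m _ _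

  cycVert≢nulVert : ∀ i j → cycVert n i ≢ nulVert n j
  cycVert≢nulVert i j eq
    with trans (sym (Finₚ.splitAt-↑ˡ m i (2 * n))) (trans (cong (Fin.splitAt m) eq) (Finₚ.splitAt-↑ʳ m (2 * n) j))
  ... | ()

  data VertexView : Vertex → Set where
    cyc : ∀ i → VertexView (cycVert n i)
    nul : ∀ j → VertexView (nulVert n j)

  vertexView : ∀ x → VertexView x
  vertexView x with Fin.splitAt m x in eq
  ... | inj₁ i = subst VertexView (Finₚ.splitAt⁻¹-↑ˡ eq) (cyc i)
  ... | inj₂ j = subst VertexView (Finₚ.splitAt⁻¹-↑ʳ eq) (nul j)

  toℕ-nextCyc : ∀ i → toℕ (nextCyc n i) ≡ suc (toℕ i) % m
  toℕ-nextCyc i = Finₚ.toℕ-fromℕ< (m%n<n (suc (toℕ i)) m)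

  nextCyc-last : nextCyc n (Fin.fromℕ (2 * n)) ≡ Fin.zero
  nextCyc-last = Finₚ.toℕ-injective (trans (toℕ-nextCyc _)
                   (trans (cong (λ t → suc t % m) (Finₚ.toℕ-fromℕ (2 * n))) (n%n≡0 m)))

  nextCyc-inject₁ : ∀ j → nextCyc n (Fin.inject₁ j) ≡ Fin.suc j
  nextCyc-inject₁ j = Finₚ.toℕ-injective (trans (toℕ-nextCyc _)
                        (trans (cong (λ t → suc t % m) (Finₚ.toℕ-inject₁ j)) (m<n⇒m%n≡m (s≤s (Finₚ.toℕ<n j)))))

  prevCyc : Fin m → Fin m
  prevCyc Fin.zero    = Fin.fromℕ (2 * n)
  prevCyc (Fin.suc j) = Fin.inject₁ j

  nextCyc-prevCyc : ∀ a → nextCyc n (prevCyc a) ≡ a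
  nextCyc-prevCyc Fin.zero    = nextCyc-last
  nextCyc-prevCyc (Fin.suc j) = nextCyc-inject₁ j

  prevCyc-nextCyc : ∀ i → prevCyc (nextCyc n i) ≡ i
  prevCyc-nextCyc i with Top.view i
  ... | Top.‵fromℕ     = cong prevCyc nextCyc-last
  ... | Top.‵inject₁ j = cong prevCyc (nextCyc-inject₁ j)

  prevCyc≢ : ∀ a → prevCyc a ≢ a
  prevCyc≢ Fin.zero    eq =
    <-irrefl (sym (trans (sym (Finₚ.toℕ-fromℕ (2 * n))) (cong toℕ eq))) (≤-trans 1≤n (m≤m+n n _))
  prevCyc≢ (Fin.suc j) eq = <-irrefl (trans (sym (Finₚ.toℕ-inject₁ j)) (cong toℕ eq)) ≤-refl

  toℕ-prevCyc : ∀ a → toℕ (prevCyc a) ≡ previous (toℕ a)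
  toℕ-prevCyc Fin.zero    = Finₚ.toℕ-fromℕ (2 * n)
  toℕ-prevCyc (Fin.suc j) = Finₚ.toℕ-inject₁ j

  walk : ℕ → Fin m
  walk zero    = Fin.zero
  walk (suc i) = nextCyc n (walk i)

  toℕ-walk : ∀ i → i < m → toℕ (walk i) ≡ i
  toℕ-walk zero    _   = refl
  toℕ-walk (suc i) i<m = trans (toℕ-nextCyc (walk i))
    (trans (cong (λ t → suc t % m) (toℕ-walk i (<-trans (n<1+n i) i<m))) (m<n⇒m%n≡m i<m))

  walk-closes : walk (suc (double n)) ≡ Fin.zero
  walk-closes = trans (cong (nextCyc n) (Finₚ.toℕ-injective
                  (trans (toℕ-walk (double n) (subst (double n <_) (sym m≡1+double) ≤-refl))
                         (trans (double≡2* n) (sym (Finₚ.toℕ-fromℕ (2 * n)))))))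
                  nextCyc-last

  rimEdge∈ : ∀ i → rimEdge i ∈ edges G
  rimEdge∈ i = ∈-++⁺ˡ (∈-map⁺ rimEdge (∈-allFin i))

  spoke∈ : ∀ i j → spoke i j ∈ edges G
  spoke∈ i j = ∈-++⁺ʳ rimEdges (∈-concat⁺′ (∈-map⁺ (spoke i) (∈-allFin j)) (∈-map⁺ spokes (∈-allFin i)))

  data EdgeView : Pair → Set where
    rim : ∀ i → EdgeView (rimEdge i)
    spk : ∀ i j → EdgeView (spoke i j)

  edgeView : ∀ {p} → p ∈ edges G → EdgeView p
  edgeView mem with ∈-++⁻ rimEdges mem
  ... | inj₁ ∈rim with ∈-map⁻ rimEdge ∈rim
  ...   | i , _ , refl = rim i
  edgeView mem | inj₂ ∈spokes with ∈-concat⁻′ (map spokes (allFin m)) ∈spokes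
  ...   | _ , ∈s , ∈ss with ∈-map⁻ spokes ∈ss
  ...     | i , _ , refl with ∈-map⁻ (spoke i) ∈s
  ...       | j , _ , refl = spk i j

  edges-unique : Unique (edges G)
  edges-unique = Uniqueₚ.++⁺ (Uniqueₚ.map⁺ (cycVert-injective ∘ cong proj₁) (Uniqueₚ.allFin⁺ m))
                            (spokeEdges-unique (allFin m) (Uniqueₚ.allFin⁺ m))
                            rim∉spokes
    where
    spoke-centre : ∀ i {p} → p ∈ spokes i → proj₁ p ≡ cycVert n i
    spoke-centre i mem with ∈-map⁻ (spoke i) mem
    ... | _ , _ , refl = refl
    spokeEdges-unique : ∀ is → Unique is → Unique (concat (map spokes is))
    spokeEdges-unique []       _          = []
    spokeEdges-unique (i ∷ is) (i∉ ∷ uniq) =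
      Uniqueₚ.++⁺ (Uniqueₚ.map⁺ (nulVert-injective ∘ cong proj₂) (Uniqueₚ.allFin⁺ (2 * n)))
                  (spokeEdges-unique is uniq) disjoint
      where
      disjoint : ∀ {p} → ¬ (p ∈ spokes i × p ∈ concat (map spokes is))
      disjoint (∈sᵢ , ∈rest) with ∈-concat⁻′ (map spokes is) ∈rest
      ... | _ , ∈s , ∈ss with ∈-map⁻ spokes ∈ss
      ...   | i′ , i′∈ , refl =
        All.lookup i∉ i′∈ (cycVert-injective (trans (sym (spoke-centre i ∈sᵢ)) (spoke-centre i′ ∈s)))
    rim∉spokes : ∀ {p} → ¬ (p ∈ rimEdges × p ∈ spokeEdges)
    rim∉spokes (∈rim , ∈spokes) with ∈-map⁻ rimEdge ∈rim | ∈-concat⁻′ (map spokes (allFin m)) ∈spokes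
    ... | i , _ , refl | _ , ∈s , ∈ss with ∈-map⁻ spokes ∈ss
    ...   | i′ , _ , refl with ∈-map⁻ (spoke i′) ∈s
    ...     | j , _ , eq = cycVert≢nulVert (nextCyc n i) j (cong proj₂ eq)

  code : Pair → ℕ
  code (a , b) with Fin.splitAt m b
  ... | inj₁ _ = magic (rimRow (toℕ a)) 0
  ... | inj₂ j = magic (spokeRow (toℕ a)) (suc (toℕ j))

  code-rimEdge : ∀ i → code (rimEdge i) ≡ magic (rimRow (toℕ i)) 0
  code-rimEdge i rewrite Finₚ.splitAt-↑ˡ m (nextCyc n i) (2 * n) | Finₚ.toℕ-↑ˡ i (2 * n) = refl

  code-spoke : ∀ i j → code (spoke i j) ≡ magic (spokeRow (toℕ i)) (suc (toℕ j))
  code-spoke i j rewrite Finₚ.splitAt-↑ʳ m (2 * n) j | Finₚ.toℕ-↑ˡ i (2 * n) = refl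

  code<m*m : ∀ p → code p < m * m
  code<m*m (a , b) with Fin.splitAt m b
  ... | inj₁ _ = magic<m*m (rimRow (toℕ a)) 0
  ... | inj₂ j = magic<m*m (spokeRow (toℕ a)) (suc (toℕ j))

  size≡m*m : size G ≡ m * m
  size≡m*m = begin
    length (rimEdges ++ spokeEdges)     ≡⟨ Listₚ.length-++ rimEdges ⟩
    length rimEdges + length spokeEdges ≡⟨ cong₂ _+_ (length-allFinMap rimEdge)
                                                  (length-concat-uniform (allFin m) spokes (2 * n) (length-allFinMap ∘ spoke)) ⟩
    m + length (allFin m) * (2 * n)     ≡⟨ cong (λ k → m + k * (2 * n)) (Listₚ.length-tabulate {n = m} (λ i → i)) ⟩
    m + m * (2 * n)                     ≡⟨ sym (*-suc m (2 * n)) ⟩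
    m * m                               ∎
    where
    open ≡-Reasoning
    length-allFinMap : ∀ {k} {B : Set} (h : Fin k → B) → length (map h (allFin k)) ≡ k
    length-allFinMap {k} h = trans (Listₚ.length-map h (allFin k)) (Listₚ.length-tabulate {n = k} (λ i → i))

  code-injective : ∀ {p q} → p ∈ edges G → q ∈ edges G → code p ≡ code q → p ≡ q
  code-injective p∈ q∈ = by-view (edgeView p∈) (edgeView q∈)
    where
    row<m : ∀ (i : Fin m) → toℕ i < m
    row<m = Finₚ.toℕ<n
    column<m : ∀ (j : Fin (2 * n)) → suc (toℕ j) < m
    column<m j = s≤s (Finₚ.toℕ<n j)
    by-view : ∀ {p q} → EdgeView p → EdgeView q → code p ≡ code q → p ≡ q
    by-view (rim i) (rim i′) eq = cong rimEdge (Finₚ.toℕ-injective (rimRow-injective (row<m i) (row<m i′)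
      (proj₁ (magic-injective (rimRow-< _ (row<m i)) (s≤s z≤n) (rimRow-< _ (row<m i′)) (s≤s z≤n)
        (trans (sym (code-rimEdge i)) (trans eq (code-rimEdge i′)))))))
    by-view (rim i) (spk i′ j′) eq = ⊥-elim (0≢1+n (proj₂
      (magic-injective (rimRow-< _ (row<m i)) (s≤s z≤n) (spokeRow-< _ (row<m i′)) (column<m j′)
        (trans (sym (code-rimEdge i)) (trans eq (code-spoke i′ j′))))))
    by-view (spk i j) (rim i′) eq = ⊥-elim (0≢1+n (sym (proj₂
      (magic-injective (spokeRow-< _ (row<m i)) (column<m j) (rimRow-< _ (row<m i′)) (s≤s z≤n)
        (trans (sym (code-spoke i j)) (trans eq (code-rimEdge i′)))))))
    by-view (spk i j) (spk i′ j′) eq = cong₂ spoke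
      (Finₚ.toℕ-injective (trans (sym (spokeRow-involutive _))
                                 (trans (cong spokeRow (proj₁ rows&columns)) (spokeRow-involutive _))))
      (Finₚ.toℕ-injective (suc-injective (proj₂ rows&columns)))
      where
      rows&columns : spokeRow (toℕ i) ≡ spokeRow (toℕ i′) × suc (toℕ j) ≡ suc (toℕ j′)
      rows&columns = magic-injective (spokeRow-< _ (row<m i)) (column<m j) (spokeRow-< _ (row<m i′)) (column<m j′)
        (trans (sym (code-spoke i j)) (trans eq (code-spoke i′ j′)))

  code<size : ∀ e → code (ends G e) < size G
  code<size e = subst (code (ends G e) <_) (sym size≡m*m) (code<m*m (ends G e))

  labeling : Labeling G
  labeling = codeLabeling G code code<size edges-unique code-injective

  weight : Vertex → Pair → ℕ
  weight x p = weightAt x p (suc (code p))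

  weight-fst : ∀ {x} p → proj₁ p ≡ x → weight x p ≡ suc (code p)
  weight-fst (a , b) = weightAt-fst

  weight-snd : ∀ {x} p → proj₂ p ≡ x → weight x p ≡ suc (code p)
  weight-snd (a , b) = weightAt-snd

  weight-neither : ∀ {x} p → proj₁ p ≢ x → proj₂ p ≢ x → weight x p ≡ 0
  weight-neither (a , b) = weightAt-neither

  rimPart spokePart : Vertex → ℕ
  rimPart   x = sum (tabulate (λ i → weight x (rimEdge i)))
  spokePart x = sum (tabulate (λ i → sum (tabulate (λ j → weight x (spoke i j)))))

  vertexSum-split : ∀ x → vertexSum G labeling x ≡ rimPart x + spokePart x
  vertexSum-split x = begin
    vertexSum G labeling x
      ≡⟨ vertexSum-byEdges G labeling (suc ∘ code) (label-codeLabeling G code code<size edges-unique code-injective) x ⟩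
    sum (map (weight x) (rimEdges ++ spokeEdges))
      ≡⟨ cong sum (Listₚ.map-++ (weight x) rimEdges spokeEdges) ⟩
    sum (map (weight x) rimEdges ++ map (weight x) spokeEdges)
      ≡⟨ sum-++ (map (weight x) rimEdges) (map (weight x) spokeEdges) ⟩
    sum (map (weight x) rimEdges) + sum (map (weight x) spokeEdges)
      ≡⟨ cong₂ _+_ (cong sum (map-allFin (weight x) rimEdge)) spokes≡ ⟩
    rimPart x + spokePart x ∎
    where
    open ≡-Reasoning
    map-allFin : ∀ {k} {B C : Set} (g : B → C) (h : Fin k → B) → map g (map h (allFin k)) ≡ tabulate (g ∘ h)
    map-allFin g h = trans (cong (map g) (Listₚ.map-tabulate (λ i → i) h)) (Listₚ.map-tabulate h g)
    spokes≡ : sum (map (weight x) spokeEdges) ≡ spokePart x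
    spokes≡ = begin
      sum (map (weight x) (concat (map spokes (allFin m))))
        ≡⟨ cong sum (sym (Listₚ.concat-map (map spokes (allFin m)))) ⟩
      sum (concat (map (map (weight x)) (map spokes (allFin m))))
        ≡⟨ sum-concat (map (map (weight x)) (map spokes (allFin m))) ⟩
      sum (map sum (map (map (weight x)) (map spokes (allFin m))))
        ≡⟨ cong (sum ∘ map sum) (sym (Listₚ.map-∘ (allFin m))) ⟩
      sum (map sum (map (map (weight x) ∘ spokes) (allFin m)))
        ≡⟨ cong sum (map-allFin sum (map (weight x) ∘ spokes)) ⟩
      sum (tabulate (λ i → sum (map (weight x) (spokes i))))
        ≡⟨ cong sum (Listₚ.tabulate-cong (λ i → cong sum (map-allFin (weight x) (spoke i)))) ⟩
      spokePart x ∎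

  rimPart-cycVert : ∀ a →
    rimPart (cycVert n a) ≡ suc (magic (rimRow (toℕ a)) 0) + suc (magic (rimRow (previous (toℕ a))) 0)
  rimPart-cycVert a = begin
    rimPart (cycVert n a)
      ≡⟨ sum-tabulate-pair (λ i → weight (cycVert n a) (rimEdge i)) a (prevCyc a) (prevCyc≢ a ∘ sym) elsewhere ⟩
    weight (cycVert n a) (rimEdge a) + weight (cycVert n a) (rimEdge (prevCyc a))
      ≡⟨ cong₂ _+_ (weight-fst (rimEdge a) refl)
                   (weight-snd (rimEdge (prevCyc a)) (cong (cycVert n) (nextCyc-prevCyc a))) ⟩
    suc (code (rimEdge a)) + suc (code (rimEdge (prevCyc a)))
      ≡⟨ cong₂ (λ u v → suc u + suc v) (code-rimEdge a)
               (trans (code-rimEdge (prevCyc a)) (cong (λ t → magic (rimRow t) 0) (toℕ-prevCyc a))) ⟩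
    suc (magic (rimRow (toℕ a)) 0) + suc (magic (rimRow (previous (toℕ a))) 0) ∎
    where
    open ≡-Reasoning
    elsewhere : ∀ i → i ≢ a → i ≢ prevCyc a → weight (cycVert n a) (rimEdge i) ≡ 0
    elsewhere i i≢a i≢prev = weight-neither (rimEdge i) (i≢a ∘ cycVert-injective)
      (λ eq → i≢prev (trans (sym (prevCyc-nextCyc i)) (cong prevCyc (cycVert-injective eq))))

  spokePart-cycVert : ∀ a → spokePart (cycVert n a) ≡ ∑< (2 * n) (λ j → suc (magic (spokeRow (toℕ a)) (suc j)))
  spokePart-cycVert a =
    trans (sum-tabulate-single (λ i → sum (tabulate (λ j → weight (cycVert n a) (spoke i j)))) a elsewhere)
          (sum-tabulate-toℕ _ (λ j → suc (magic (spokeRow (toℕ a)) (suc j)))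
                            (λ j → trans (weight-fst (spoke a j) refl) (cong suc (code-spoke a j))))
    where
    elsewhere : ∀ i → i ≢ a → sum (tabulate (λ j → weight (cycVert n a) (spoke i j))) ≡ 0
    elsewhere i i≢a = sum-tabulate-zero (λ j → weight (cycVert n a) (spoke i j))
      (λ j → weight-neither (spoke i j) (i≢a ∘ cycVert-injective) (cycVert≢nulVert a j ∘ sym))

  rimPart-nulVert : ∀ b → rimPart (nulVert n b) ≡ 0
  rimPart-nulVert b = sum-tabulate-zero (λ i → weight (nulVert n b) (rimEdge i))
    (λ i → weight-neither (rimEdge i) (cycVert≢nulVert i b) (cycVert≢nulVert (nextCyc n i) b))

  spokePart-nulVert : ∀ b → spokePart (nulVert n b) ≡ ∑< m (λ i → suc (magic (spokeRow i) (suc (toℕ b))))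
  spokePart-nulVert b = sum-tabulate-toℕ _ (λ i → suc (magic (spokeRow i) (suc (toℕ b)))) λ i →
    trans (sum-tabulate-single (λ j → weight (nulVert n b) (spoke i j)) b
            (λ j j≢b → weight-neither (spoke i j) (cycVert≢nulVert i b) (j≢b ∘ nulVert-injective)))
          (trans (weight-snd (spoke i b) refl) (cong suc (code-spoke i b)))

  rimSum : ℕ → ℕ
  rimSum c = magicSum + suc m * (n + c)

  nullSum : ℕ
  nullSum = m + magicSum

  private
    -- each of the 2 * n + 2 edges at a rim vertex adds 1 to its code, together one more suc m
    rimSum-arithmetic : ∀ k x y z c S M → x + y + 1 ≡ z + (k + c) → suc (suc (2 * k)) * z + S ≡ M →
      suc (suc (suc (2 * k)) * x) + suc (suc (suc (2 * k)) * y) + (2 * k + S) ≡ M + suc (suc (2 * k)) * (k + c)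
    rimSum-arithmetic k x y z c S M balance row = +-cancelʳ-≡ (suc (suc (2 * k)) * z) _ _ (begin
      suc (suc (suc (2 * k)) * x) + suc (suc (suc (2 * k)) * y) + (2 * k + S) + suc (suc (2 * k)) * z
        ≡⟨ regroup k x y z S ⟩
      suc (suc (2 * k)) * (x + y + 1) + (suc (suc (2 * k)) * z + S)
        ≡⟨ cong₂ (λ a b → suc (suc (2 * k)) * a + b) balance row ⟩
      suc (suc (2 * k)) * (z + (k + c)) + M
        ≡⟨ distribute k z c M ⟩
      M + suc (suc (2 * k)) * (k + c) + suc (suc (2 * k)) * z ∎)
      where
      open ≡-Reasoning
      regroup : ∀ k x y z S →
        suc (suc (suc (2 * k)) * x) + suc (suc (suc (2 * k)) * y) + (2 * k + S) + suc (suc (2 * k)) * z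
          ≡ suc (suc (2 * k)) * (x + y + 1) + (suc (suc (2 * k)) * z + S)
      regroup = solve-∀
      distribute : ∀ k z c M →
        suc (suc (2 * k)) * (z + (k + c)) + M ≡ M + suc (suc (2 * k)) * (k + c) + suc (suc (2 * k)) * z
      distribute = solve-∀

  vertexSum-cycVert : ∀ a → vertexSum G labeling (cycVert n a) ≡ rimSum (rimColour (toℕ a))
  vertexSum-cycVert a = begin
    vertexSum G labeling (cycVert n a)
      ≡⟨ trans (vertexSum-split (cycVert n a)) (cong₂ _+_ (rimPart-cycVert a) (spokePart-cycVert a)) ⟩
    suc (magic (rimRow α) 0) + suc (magic (rimRow (previous α)) 0) + ∑< (2 * n) (suc ∘ spokeEntry)
      ≡⟨ cong₂ _+_ (cong₂ (λ u v → suc u + suc v) (magic-column₀ _ (rimRow-< _ α<m)) (magic-column₀ _ (rimRow-< _ π<m)))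
                   (∑-suc (2 * n) spokeEntry) ⟩
    suc (suc m * rimRow α) + suc (suc m * rimRow (previous α)) + (2 * n + ∑< (2 * n) spokeEntry)
      ≡⟨ rimSum-arithmetic n (rimRow α) (rimRow (previous α)) (spokeRow α) (rimColour α) _ magicSum
                           (rimRow-balance α) row ⟩
    rimSum (rimColour α) ∎
    where
    open ≡-Reasoning
    α : ℕ
    α = toℕ a
    α<m : α < m
    α<m = Finₚ.toℕ<n a
    π<m : previous α < m
    π<m = subst (_< m) (toℕ-prevCyc a) (Finₚ.toℕ<n (prevCyc a))
    spokeEntry : ℕ → ℕ
    spokeEntry j = magic (spokeRow α) (suc j)
    row : suc m * spokeRow α + ∑< (2 * n) spokeEntry ≡ magicSum
    row = trans (cong (_+ ∑< (2 * n) spokeEntry) (sym (magic-column₀ _ (spokeRow-< _ α<m))))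
                (∑-magic-row (spokeRow α) (spokeRow-< _ α<m))

  vertexSum-nulVert : ∀ b → vertexSum G labeling (nulVert n b) ≡ nullSum
  vertexSum-nulVert b = begin
    vertexSum G labeling (nulVert n b)
      ≡⟨ trans (vertexSum-split (nulVert n b)) (cong₂ _+_ (rimPart-nulVert b) (spokePart-nulVert b)) ⟩
    ∑< m (suc ∘ columnEntry)
      ≡⟨ ∑-suc m columnEntry ⟩
    m + ∑< m columnEntry
      ≡⟨ cong (m +_) (∑-spokeRow (λ p → magic p (suc (toℕ b)))) ⟩
    m + ∑< m (λ p → magic p (suc (toℕ b)))
      ≡⟨ cong (m +_) (∑-magic-column (suc (toℕ b)) (s≤s (<⇒≤ (Finₚ.toℕ<n b)))) ⟩
    nullSum ∎
    where
    open ≡-Reasoning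
    columnEntry : ℕ → ℕ
    columnEntry i = magic (spokeRow i) (suc (toℕ b))

  rimSum-injective : ∀ {c c′} → rimSum c ≡ rimSum c′ → c ≡ c′
  rimSum-injective {c} {c′} eq =
    +-cancelˡ-≡ n c c′ (*-cancelˡ-≡ (n + c) (n + c′) (suc m) (+-cancelˡ-≡ magicSum _ _ eq))

  nullSum<rimSum : ∀ c → nullSum < rimSum c
  nullSum<rimSum c = begin-strict
    m + magicSum              ≡⟨ +-comm m magicSum ⟩
    magicSum + m              <⟨ +-monoʳ-< magicSum (n<1+n m) ⟩
    magicSum + suc m          ≡⟨ cong (magicSum +_) (sym (*-identityʳ (suc m))) ⟩
    magicSum + suc m * 1      ≤⟨ +-monoʳ-≤ magicSum (*-monoʳ-≤ (suc m) (≤-trans 1≤n (m≤m+n n c))) ⟩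
    magicSum + suc m * (n + c) ∎
    where open ≤-Reasoning

  antimagic : IsLocalAntimagic G labeling
  antimagic = isLocalAntimagic-byEdges G labeling (proper ∘ edgeView)
    where
    proper : ∀ {x y} → EdgeView (x , y) → vertexSum G labeling x ≢ vertexSum G labeling y
    proper (rim i) eq = rimColour-proper 1≤n (toℕ i) (Finₚ.toℕ<n i) (trans
      (rimSum-injective (trans (sym (vertexSum-cycVert i)) (trans eq (vertexSum-cycVert (nextCyc n i)))))
      (cong rimColour (toℕ-nextCyc i)))
    proper (spk i j) eq = <-irrefl (trans (sym (vertexSum-nulVert j)) (trans (sym eq) (vertexSum-cycVert i)))
                                   (nullSum<rimSum (rimColour (toℕ i)))

  colours : List ℕ
  colours = map rimSum (upTo 3) ++ nullSum ∷ []

  vertexSum∈colours : ∀ x → vertexSum G labeling x ∈ colours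
  vertexSum∈colours x with vertexView x
  ... | cyc i = subst (_∈ colours) (sym (vertexSum-cycVert i))
                      (∈-++⁺ˡ (∈-map⁺ rimSum (∈-upTo⁺ (rimColour-< (toℕ i)))))
  ... | nul j = subst (_∈ colours) (sym (vertexSum-nulVert j)) (∈-++⁺ʳ (map rimSum (upTo 3)) (here refl))

  fourColoursNeeded : ∀ f → IsLocalAntimagic G f → 4 ≤ numColours G f
  fourColoursNeeded f antimagic = oddWheel⇒4≤numColours G f antimagic n (cycVert n ∘ walk) (nulVert n j₀)
    (λ i _ → ∈-edges⇒adjacent G (rimEdge∈ (walk i)))
    (subst (Adjacent G (cycVert n (walk (double n))) ∘ cycVert n) walk-closes
           (∈-edges⇒adjacent G (rimEdge∈ (walk (double n)))))
    (λ i → ∈-edges⇒adjacent G (spoke∈ (walk i) j₀))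
    where
    j₀ : Fin (2 * n)
    j₀ = fromℕ< (≤-trans 1≤n (m≤m+n n _))

mainTheorem9 : (n : ℕ) → 1 ≤ n → LocalAntimagicChromaticNumberIs (oddCycleJoinNull n) 4
mainTheorem9 n 1≤n =
  (labeling , antimagic , ≤-antisym (numColours≤ G labeling vertexSum∈colours) (fourColoursNeeded labeling antimagic))
  , fourColoursNeeded
  where open JoinGraph n 1≤n
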